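{- Each of $S_n(132, 231)$, $S_n(312, 213)$, $S_n(132, 312)$ and $S_n(231, 213)$ is sign-balanced for every integer $n>1$.
   Context: For $\sigma\in S_k$, $\pi\in S_n$ (one-line notation), $k\le n$, $\pi$ contains $\sigma$ if there are indices $i_1<\cdots<i_k$ with $\pi_{i_s}>\pi_{i_t}$ iff $\sigma_s>\sigma_t$ for all $s<t$; otherwise $\pi$ avoids $\sigma$. $S_n(\sigma_1,\ldots,\sigma_r)$ is the set of permutations in $S_n$ avoiding every $\sigma_j$. A permutation is even (odd) if its number of inversions (pairs $i<j$ with $\pi_i>\pi_j$) is even (odd). A set of permutations is sign-balanced if it contains equally many even and odd permutations. -}

module Defs where

open import Data.Nat using (ℕ; zero; suc; _+_; _*_)
open import Data.Nat.DivMod using (_%_)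
open import Data.Fin using (Fin; _<_; _>_; _<?_)
open import Data.Fin.Patterns using (0F; 1F; 2F)
open import Data.Product using (Σ; ∃; _×_; _,_; proj₁)
open import Data.Bool using (Bool; true; false)
open import Function.Definitions using (Injective)
open import Function.Bundles using (_↔_)
open import Relation.Binary.PropositionalEquality using (_≡_; refl)
open import Relation.Nullary using (¬_; Dec; yes; no)
open import Relation.Nullary.Decidable using (⌊_⌋)
open import Data.Vec using (Vec; lookup; []; _∷_)
open import Data.Irrelevant using (Irrelevant; [_])
open import Data.Fin.Base using (toℕ)

-- A permutation of [n] in one-line notation: a word π₁…πₙ over Fin n (values 1..n
-- written 0..n-1) whose entries are distinct, i.e. i ↦ πᵢ is injective (hence bijective).
-- The injectivity proof is irrelevant, so two permutations are equal iff their words are.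
Perm : ℕ → Set
Perm n = Σ (Vec (Fin n) n) λ w → Irrelevant (Injective _≡_ _≡_ (lookup w))

⟦_⟧ : {n : ℕ} → Perm n → Fin n → Fin n
⟦ w , _ ⟧ = lookup w

sumFin : (n : ℕ) → (Fin n → ℕ) → ℕ
sumFin zero    f = 0
sumFin (suc n) f = f Data.Fin.zero + sumFin n (λ i → f (Data.Fin.suc i))


ind : {P : Set} → Dec P → ℕ
ind (yes _) = 1
ind (no _)  = 0

inv : {n : ℕ} → Perm n → ℕ
inv {n} p = sumFin n (λ i → sumFin n (λ j → ind (i <? j) * ind (⟦ p ⟧ j <? ⟦ p ⟧ i)))


IsEven : {n : ℕ} → Perm n → Set
IsEven π = inv π % 2 ≡ 0

IsOdd : {n : ℕ} → Perm n → Set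
IsOdd π = inv π % 2 ≡ 1

Contains : {k n : ℕ} → Perm n → Perm k → Set
Contains {k} {n} p q =
  Σ (Fin k → Fin n) λ ι →
    (∀ s t → s < t → ι s < ι t) ×
    (∀ s t → s < t → (⟦ p ⟧ (ι s) > ⟦ p ⟧ (ι t) → ⟦ q ⟧ s > ⟦ q ⟧ t) ×
                     (⟦ q ⟧ s > ⟦ q ⟧ t → ⟦ p ⟧ (ι s) > ⟦ p ⟧ (ι t)))

Avoids : {k n : ℕ} → Perm n → Perm k → Set
Avoids π σ = ¬ Contains π σ

-- sign-balanced: the even and odd members of the set {π ∈ S_n | P π} are equinumerous
-- (membership proofs are irrelevant, so these Σ-types are genuine subsets of S_n;
-- a bijection between finite sets = equal cardinalities)
SignBalanced : (n : ℕ) → (Perm n → Set) → Set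
SignBalanced n P =
  (Σ (Perm n) λ π → Irrelevant (P π × IsEven π)) ↔ (Σ (Perm n) λ π → Irrelevant (P π × IsOdd π))

-- patterns of length 3 in one-line notation (values 1,2,3 written 0F,1F,2F)
p132 : Perm 3
p132 = w , [ inj ]
  where
  w : Vec (Fin 3) 3
  w = 0F ∷ 2F ∷ 1F ∷ []
  inj : Injective _≡_ _≡_ (lookup w)
  inj {0F} {0F} _ = refl
  inj {0F} {1F} ()
  inj {0F} {2F} ()
  inj {1F} {0F} ()
  inj {1F} {1F} _ = refl
  inj {1F} {2F} ()
  inj {2F} {0F} ()
  inj {2F} {1F} ()
  inj {2F} {2F} _ = refl

p231 : Perm 3
p231 = w , [ inj ]
  where
  w : Vec (Fin 3) 3
  w = 1F ∷ 2F ∷ 0F ∷ []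
  inj : Injective _≡_ _≡_ (lookup w)
  inj {0F} {0F} _ = refl
  inj {0F} {1F} ()
  inj {0F} {2F} ()
  inj {1F} {0F} ()
  inj {1F} {1F} _ = refl
  inj {1F} {2F} ()
  inj {2F} {0F} ()
  inj {2F} {1F} ()
  inj {2F} {2F} _ = refl

p312 : Perm 3
p312 = w , [ inj ]
  where
  w : Vec (Fin 3) 3
  w = 2F ∷ 0F ∷ 1F ∷ []
  inj : Injective _≡_ _≡_ (lookup w)
  inj {0F} {0F} _ = refl
  inj {0F} {1F} ()
  inj {0F} {2F} ()
  inj {1F} {0F} ()
  inj {1F} {1F} _ = refl
  inj {1F} {2F} ()
  inj {2F} {0F} ()
  inj {2F} {1F} ()
  inj {2F} {2F} _ = refl

p213 : Perm 3
p213 = w , [ inj ]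
  where
  w : Vec (Fin 3) 3
  w = 1F ∷ 0F ∷ 2F ∷ []
  inj : Injective _≡_ _≡_ (lookup w)
  inj {0F} {0F} _ = refl
  inj {0F} {1F} ()
  inj {0F} {2F} ()
  inj {1F} {0F} ()
  inj {1F} {1F} _ = refl
  inj {1F} {2F} ()
  inj {2F} {0F} ()
  inj {2F} {1F} ()
  inj {2F} {2F} _ = refl

Av2 : {n : ℕ} → Perm 3 → Perm 3 → Perm n → Set
Av2 σ τ π = Avoids π σ × Avoids π τ

-- Each of the four sets is closed under an involution that exchanges two adjacent entries:
-- the values 1 and 2 for S_n(132, 231), the values n-1 and n for S_n(312, 213), the first
-- two positions for S_n(132, 312) and the last two positions for S_n(231, 213).  Exchanging
-- two adjacent values, or two adjacent positions, changes the number of inversions by exactly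
-- one, so the involution pairs even permutations with odd ones.  It preserves the set because
-- it can only alter the shape of a pattern occurrence that uses both exchanged entries, and
-- since these are extreme (the two smallest values, the two leftmost positions, ...), it then
-- turns an occurrence of one forbidden pattern into one of the other: swapping the values
-- 1, 2 exchanges 132 and 231, swapping the first two positions exchanges 132 and 312, etc.

module Submission where

open import Defs
open import Data.Nat using (ℕ; zero; suc; _+_; _*_; _≤_; _>_; z<s; s<s; s≤s⁻¹)
open import Data.Nat.DivMod using (_%_)
import Data.Nat.Properties as ℕ
open import Algebra.Properties.CommutativeMonoid.Sum ℕ.+-0-commutativeMonoid
  using (sum; sum-cong-≗; sum-remove; sum-permute)
open import Algebra.Properties.CommutativeSemigroup ℕ.+-commutativeSemigroup
  using (xy∙z≈zy∙x; xy∙z≈xz∙y; x∙yz≈xz∙y)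
open import Data.Fin as Fin using (Fin; toℕ; _<_; _<?_; _≮_; fromℕ; inject₁; punchIn; punchOut)
open import Data.Fin.Patterns using (0F; 1F; 2F)
open import Data.Fin.Properties
  using (_≟_; <-cmp; <-irrefl; <-asym; <-trans; ≤∧≢⇒<; toℕ-inject₁; ≤fromℕ; any?; pigeonhole;
         punchOut-injective; punchInᵢ≢i)
import Data.Fin.Permutation as Permutation
open import Data.Fin.Permutation.Components using (transpose)
import Data.Product as Product
open import Data.Product using (Σ; _×_; _,_; proj₁; proj₂)
open import Data.Product.Properties using (,-injectiveˡ; ,-injectiveʳ; ≡-dec; Σ-≡,≡→≡)
open import Data.Irrelevant using (Irrelevant; [_])
open import Data.Vec using (tabulate)
open import Data.Vec.Properties using (lookup∘tabulate; tabulate∘lookup; tabulate-cong)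
import Data.Sum as Sum
open import Data.Sum using (_⊎_; inj₁; inj₂)
open import Data.Empty using (⊥-elim)
open import Function using (_∘_)
open import Function.Definitions using (Injective; StrictlySurjective; StrictlyInverseˡ; StrictlyInverseʳ)
open import Function.Bundles using (mk↔ₛ′)
open import Relation.Binary.PropositionalEquality
open import Relation.Binary.Definitions using (DecidableEquality; tri<; tri≈; tri>)
open import Relation.Nullary using (¬_; Dec; yes; no; contradiction)
open import Relation.Nullary.Decidable using (dec-true; dec-false; recompute)

OneApart : ℕ → ℕ → Set
OneApart m k = suc m ≡ k ⊎ m ≡ suc k

%2-suc : ∀ m → (m % 2 ≡ 0 × suc m % 2 ≡ 1) ⊎ (m % 2 ≡ 1 × suc m % 2 ≡ 0)
%2-suc zero = inj₁ (refl , refl)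
%2-suc (suc m) with %2-suc m
... | inj₁ (m-even , sm-odd) = inj₂ (sm-odd , m-even)
... | inj₂ (m-odd , sm-even) = inj₁ (sm-even , m-odd)

oneApart-even⇒odd : ∀ {m k} → OneApart m k → k % 2 ≡ 0 → m % 2 ≡ 1
oneApart-even⇒odd {m} (inj₁ refl) k-even with %2-suc m
... | inj₁ (_ , sm-odd) = contradiction (trans (sym k-even) sm-odd) λ ()
... | inj₂ (m-odd , _)  = m-odd
oneApart-even⇒odd {k = k} (inj₂ refl) k-even with %2-suc k
... | inj₁ (_ , sk-odd) = sk-odd
... | inj₂ (k-odd , _)  = contradiction (trans (sym k-even) k-odd) λ ()

oneApart-odd⇒even : ∀ {m k} → OneApart m k → k % 2 ≡ 1 → m % 2 ≡ 0
oneApart-odd⇒even {m} (inj₁ refl) k-odd with %2-suc m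
... | inj₁ (m-even , _) = m-even
... | inj₂ (_ , sm-even) = contradiction (trans (sym k-odd) sm-even) λ ()
oneApart-odd⇒even {k = k} (inj₂ refl) k-odd with %2-suc k
... | inj₁ (k-even , _) = contradiction (trans (sym k-odd) k-even) λ ()
... | inj₂ (_ , sk-even) = sk-even

ind-yes : {P : Set} (p? : Dec P) → P → ind p? ≡ 1
ind-yes (yes _) _ = refl
ind-yes (no ¬p) p = contradiction p ¬p

ind-no : {P : Set} (p? : Dec P) → ¬ P → ind p? ≡ 0
ind-no (yes p) ¬p = contradiction p ¬p
ind-no (no _)  _  = refl

ind-⇔ : {P Q : Set} (p? : Dec P) (q? : Dec Q) → (P → Q) → (Q → P) → ind p? ≡ ind q?
ind-⇔ p? (yes q) _   Q⇒P = ind-yes p? (Q⇒P q)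
ind-⇔ p? (no ¬q) P⇒Q _   = ind-no p? (¬q ∘ P⇒Q)

oneApart-by-comparison : ∀ {n m k} {x y : Fin n} → x ≢ y →
                         m + ind (y <? x) ≡ k + ind (x <? y) → OneApart m k
oneApart-by-comparison {m = m} {k} {x} {y} x≢y eq with <-cmp x y
... | tri< x<y _ y≮x = inj₂ (begin
  m                    ≡⟨ ℕ.+-identityʳ m ⟨
  m + 0                ≡⟨ cong (m +_) (ind-no (y <? x) y≮x) ⟨
  m + ind (y <? x)     ≡⟨ eq ⟩
  k + ind (x <? y)     ≡⟨ cong (k +_) (ind-yes (x <? y) x<y) ⟩
  k + 1                ≡⟨ ℕ.+-comm k 1 ⟩
  suc k                ∎)
  where open ≡-Reasoning
... | tri≈ _ x≡y _ = contradiction x≡y x≢y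
... | tri> x≮y _ y<x = inj₁ (begin
  suc m                ≡⟨ ℕ.+-comm 1 m ⟩
  m + 1                ≡⟨ cong (m +_) (ind-yes (y <? x) y<x) ⟨
  m + ind (y <? x)     ≡⟨ eq ⟩
  k + ind (x <? y)     ≡⟨ cong (k +_) (ind-no (x <? y) x≮y) ⟩
  k + 0                ≡⟨ ℕ.+-identityʳ k ⟩
  k                    ∎)
  where open ≡-Reasoning

sumFin≡sum : ∀ n (f : Fin n → ℕ) → sumFin n f ≡ sum f
sumFin≡sum zero    f = refl
sumFin≡sum (suc n) f = cong (f Fin.zero +_) (sumFin≡sum n (f ∘ Fin.suc))

sum² : ∀ {n} → (Fin n → Fin n → ℕ) → ℕ
sum² c = sum (λ i → sum (c i))

sum²-permute : ∀ {n} (c : Fin n → Fin n → ℕ) (ρ : Permutation.Permutation n n) →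
               sum² c ≡ sum² (λ i j → c (ρ Permutation.⟨$⟩ʳ i) (ρ Permutation.⟨$⟩ʳ j))
sum²-permute c ρ = trans (sum-cong-≗ (λ i → sum-permute (c i) ρ)) (sum-permute _ ρ)

sum-agreeOff : ∀ {n} {f g : Fin n → ℕ} (k : Fin n) → (∀ i → i ≢ k → f i ≡ g i) →
               sum f + g k ≡ sum g + f k
sum-agreeOff {suc n} {f} {g} k agree = begin
  sum f + g k                        ≡⟨ cong (_+ g k) (sum-remove {i = k} f) ⟩
  (f k + sum (f ∘ punchIn k)) + g k  ≡⟨ cong (λ r → (f k + r) + g k) (sum-cong-≗ (λ i → agree (punchIn k i) (punchInᵢ≢i k i))) ⟩
  (f k + sum (g ∘ punchIn k)) + g k  ≡⟨ xy∙z≈zy∙x (f k) _ (g k) ⟩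
  (g k + sum (g ∘ punchIn k)) + f k  ≡⟨ cong (_+ f k) (sum-remove {i = k} g) ⟨
  sum g + f k                        ∎
  where open ≡-Reasoning

sum²-agreeOff : ∀ {n} {c d : Fin n → Fin n → ℕ} (x y : Fin n) →
                (∀ i j → (i , j) ≢ (x , y) → c i j ≡ d i j) →
                sum² c + d x y ≡ sum² d + c x y
sum²-agreeOff {c = c} {d} x y agree = ℕ.+-cancelʳ-≡ (sum (d x)) _ _ (begin
  (sum² c + d x y) + sum (d x)  ≡⟨ xy∙z≈xz∙y (sum² c) (d x y) (sum (d x)) ⟩
  (sum² c + sum (d x)) + d x y  ≡⟨ cong (_+ d x y) rows ⟩
  (sum² d + sum (c x)) + d x y  ≡⟨ ℕ.+-assoc (sum² d) (sum (c x)) (d x y) ⟩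
  sum² d + (sum (c x) + d x y)  ≡⟨ cong (sum² d +_) row ⟩
  sum² d + (sum (d x) + c x y)  ≡⟨ x∙yz≈xz∙y (sum² d) (sum (d x)) (c x y) ⟩
  (sum² d + c x y) + sum (d x)  ∎)
  where
  open ≡-Reasoning
  rows : sum² c + sum (d x) ≡ sum² d + sum (c x)
  rows = sum-agreeOff x (λ i i≢x → sum-cong-≗ (λ j → agree i j (i≢x ∘ ,-injectiveˡ)))
  row : sum (c x) + d x y ≡ sum (d x) + c x y
  row = sum-agreeOff y (λ j j≢y → agree x j (j≢y ∘ ,-injectiveʳ))

sum²-agreeOff₂ : ∀ {n} {c d : Fin n → Fin n → ℕ} {x y : Fin n} → x ≢ y →
                 (∀ i j → (i , j) ≢ (x , y) → (i , j) ≢ (y , x) → c i j ≡ d i j) →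
                 sum² c + (d x y + d y x) ≡ sum² d + (c x y + c y x)
sum²-agreeOff₂ {n} {c} {d} {x} {y} x≢y agree = begin
  sum² c + (d x y + d y x)  ≡⟨ ℕ.+-assoc (sum² c) _ _ ⟨
  sum² c + d x y + d y x    ≡⟨ cong (λ v → sum² c + v + d y x) e-xy ⟨
  sum² c + e x y + d y x    ≡⟨ cong (_+ d y x) (sum²-agreeOff x y c≈e) ⟩
  sum² e + c x y + d y x    ≡⟨ xy∙z≈xz∙y (sum² e) _ _ ⟩
  sum² e + d y x + c x y    ≡⟨ cong (_+ c x y) (sum²-agreeOff y x e≈d) ⟩
  sum² d + e y x + c x y    ≡⟨ cong (λ v → sum² d + v + c x y) e-yx ⟩
  sum² d + c y x + c x y    ≡⟨ xy∙z≈xz∙y (sum² d) _ _ ⟩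
  sum² d + c x y + c y x    ≡⟨ ℕ.+-assoc (sum² d) _ _ ⟩
  sum² d + (c x y + c y x)  ∎
  where
  open ≡-Reasoning
  _≟₂_ : DecidableEquality (Fin n × Fin n)
  _≟₂_ = ≡-dec _≟_ _≟_
  e : Fin n → Fin n → ℕ
  e i j with (i , j) ≟₂ (x , y)
  ... | yes _ = d x y
  ... | no  _ = c i j
  c≈e : ∀ i j → (i , j) ≢ (x , y) → c i j ≡ e i j
  c≈e i j ij≢xy with (i , j) ≟₂ (x , y)
  ... | yes ij≡xy = contradiction ij≡xy ij≢xy
  ... | no  _     = refl
  e≈d : ∀ i j → (i , j) ≢ (y , x) → e i j ≡ d i j
  e≈d i j ij≢yx with (i , j) ≟₂ (x , y)
  ... | yes refl   = refl
  ... | no ij≢xy   = agree i j ij≢xy ij≢yx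
  e-xy : e x y ≡ d x y
  e-xy with (x , y) ≟₂ (x , y)
  ... | yes _     = refl
  ... | no xy≢xy  = contradiction refl xy≢xy
  e-yx : e y x ≡ c y x
  e-yx with (y , x) ≟₂ (x , y)
  ... | yes yx≡xy = contradiction (,-injectiveʳ yx≡xy) x≢y
  ... | no  _     = refl

transposeˡ : ∀ {n} (i j : Fin n) → transpose i j i ≡ j
transposeˡ i j rewrite dec-true (i ≟ i) refl = refl

transposeʳ : ∀ {n} (i j : Fin n) → transpose i j j ≡ i
transposeʳ i j with j ≟ i
... | yes refl = refl
... | no _ rewrite dec-true (j ≟ j) refl = refl

transpose-fix : ∀ {n} {i j k : Fin n} → k ≢ i → k ≢ j → transpose i j k ≡ k
transpose-fix {i = i} {j} {k} k≢i k≢j rewrite dec-false (k ≟ i) k≢i | dec-false (k ≟ j) k≢j = refl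

transpose-cases : ∀ {n} (i j k : Fin n) →
                  (k ≡ i × transpose i j k ≡ j) ⊎ (k ≡ j × transpose i j k ≡ i) ⊎
                  (k ≢ i × k ≢ j × transpose i j k ≡ k)
transpose-cases i j k = by-cases (k ≟ i) (k ≟ j)
  where
  by-cases : Dec (k ≡ i) → Dec (k ≡ j) →
             (k ≡ i × transpose i j k ≡ j) ⊎ (k ≡ j × transpose i j k ≡ i) ⊎
             (k ≢ i × k ≢ j × transpose i j k ≡ k)
  by-cases (yes k≡i) _         = inj₁ (k≡i , trans (cong (transpose i j) k≡i) (transposeˡ i j))
  by-cases (no _)    (yes k≡j) = inj₂ (inj₁ (k≡j , trans (cong (transpose i j) k≡j) (transposeʳ i j)))
  by-cases (no k≢i)  (no k≢j)  = inj₂ (inj₂ (k≢i , k≢j , transpose-fix k≢i k≢j))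

transpose-involutive : ∀ {n} (i j k : Fin n) → transpose i j (transpose i j k) ≡ k
transpose-involutive i j k with transpose-cases i j k
... | inj₁ (refl , e)             = trans (cong (transpose k j) e) (transposeʳ k j)
... | inj₂ (inj₁ (refl , e))      = trans (cong (transpose i k) e) (transposeˡ i k)
... | inj₂ (inj₂ (_ , _ , e))     = trans (cong (transpose i j) e) e

inversions : ∀ {n} → (Fin n → Fin n) → ℕ
inversions f = sum² (λ i j → ind (i <? j) * ind (f j <? f i))

inv≡inversions : ∀ {n} (π : Perm n) → inv π ≡ inversions ⟦ π ⟧
inv≡inversions {n} π = trans (sumFin≡sum n _)
  (sum-cong-≗ λ i → sumFin≡sum n (λ j → ind (i <? j) * ind (⟦ π ⟧ j <? ⟦ π ⟧ i)))

inversions-cong : ∀ {n} {f g : Fin n → Fin n} → f ≗ g → inversions f ≡ inversions g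
inversions-cong f≗g = sum-cong-≗ λ i → sum-cong-≗ λ j →
  cong₂ (λ u v → ind (i <? j) * ind (u <? v)) (f≗g j) (f≗g i)

⟦⟧-injective : ∀ {n} (π : Perm n) → Injective _≡_ _≡_ ⟦ π ⟧
⟦⟧-injective (_ , [ inj ]) {x} {y} e = recompute (x ≟ y) (inj e)

injective⇒strictlySurjective : ∀ {n} {f : Fin n → Fin n} → Injective _≡_ _≡_ f → StrictlySurjective _≡_ f
injective⇒strictlySurjective {suc m} {f} f-inj y with any? (λ x → f x ≟ y)
... | yes hit  = hit
... | no ¬hit =
  let i , j , i<j , eq = pigeonhole (ℕ.n<1+n m) (λ x → punchOut (y≢f x))
  in  ⊥-elim (<-irrefl (f-inj (punchOut-injective (y≢f i) (y≢f j) eq)) i<j)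
  where
  y≢f : ∀ x → y ≢ f x
  y≢f x y≡fx = ¬hit (x , sym y≡fx)

fromInjection : ∀ {n} (g : Fin n → Fin n) → Injective _≡_ _≡_ g → Perm n
fromInjection g g-inj = tabulate g , [ (λ {x} {y} e →
  g-inj (trans (sym (lookup∘tabulate g x)) (trans e (lookup∘tabulate g y)))) ]

⟦fromInjection⟧ : ∀ {n} (g : Fin n → Fin n) (g-inj : Injective _≡_ _≡_ g) → ⟦ fromInjection g g-inj ⟧ ≗ g
⟦fromInjection⟧ g _ = lookup∘tabulate g

≗⇒≡ : ∀ {n} {π ρ : Perm n} → ⟦ π ⟧ ≗ ⟦ ρ ⟧ → π ≡ ρ
≗⇒≡ {π = w , _} {v , _} π≗ρ
  with trans (sym (tabulate∘lookup w)) (trans (tabulate-cong π≗ρ) (tabulate∘lookup v))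
... | refl = refl

signBalanced-byInvolution : ∀ {n} (P : Perm n → Set) (φ : Perm n → Perm n) →
                            (∀ π → φ (φ π) ≡ π) → (∀ π → OneApart (inv (φ π)) (inv π)) →
                            (∀ {π} → P π → P (φ π)) → SignBalanced n P
signBalanced-byInvolution P φ φ-involutive φ-oneApart φ-preserves =
  mk↔ₛ′ even⇒odd odd⇒even (λ _ → Σ-≡,≡→≡ (φ-involutive _ , refl)) (λ _ → Σ-≡,≡→≡ (φ-involutive _ , refl))
  where
  even⇒odd : Σ (Perm _) (λ π → Irrelevant (P π × IsEven π)) → Σ (Perm _) (λ π → Irrelevant (P π × IsOdd π))
  even⇒odd (π , [ p ]) = φ π , [ (φ-preserves (proj₁ p) , oneApart-even⇒odd (φ-oneApart π) (proj₂ p)) ]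
  odd⇒even : Σ (Perm _) (λ π → Irrelevant (P π × IsOdd π)) → Σ (Perm _) (λ π → Irrelevant (P π × IsEven π))
  odd⇒even (π , [ p ]) = φ π , [ (φ-preserves (proj₁ p) , oneApart-odd⇒even (φ-oneApart π) (proj₂ p)) ]

record SignReversingAction (n : ℕ) : Set where
  field
    act            : (Fin n → Fin n) → Fin n → Fin n
    act-injective  : ∀ {f} → Injective _≡_ _≡_ f → Injective _≡_ _≡_ (act f)
    act-cong       : ∀ {f g} → f ≗ g → act f ≗ act g
    act-involutive : ∀ f → act (act f) ≗ f
    inversions-act : ∀ {f} → Injective _≡_ _≡_ f → OneApart (inversions (act f)) (inversions f)

  actₚ : Perm n → Perm n
  actₚ π = fromInjection (act ⟦ π ⟧) (act-injective (⟦⟧-injective π))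

  ⟦actₚ⟧ : ∀ π → ⟦ actₚ π ⟧ ≗ act ⟦ π ⟧
  ⟦actₚ⟧ π = ⟦fromInjection⟧ (act ⟦ π ⟧) (act-injective (⟦⟧-injective π))

  actₚ-involutive : ∀ π → actₚ (actₚ π) ≡ π
  actₚ-involutive π = ≗⇒≡ λ x →
    trans (⟦actₚ⟧ (actₚ π) x) (trans (act-cong (⟦actₚ⟧ π) x) (act-involutive ⟦ π ⟧ x))

  inv-actₚ : ∀ π → OneApart (inv (actₚ π)) (inv π)
  inv-actₚ π = subst₂ OneApart
    (sym (trans (inv≡inversions (actₚ π)) (inversions-cong (⟦actₚ⟧ π))))
    (sym (inv≡inversions π))
    (inversions-act (⟦⟧-injective π))

  signBalanced : (P : Perm n → Set) → (∀ {π} → P π → P (actₚ π)) → SignBalanced n P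
  signBalanced P = signBalanced-byInvolution P actₚ actₚ-involutive inv-actₚ

Increasing₃ : ∀ {n} → (Fin 3 → Fin n) → Set
Increasing₃ v = v 0F < v 1F × v 1F < v 2F

Increasing₃-≗ : ∀ {n} {v w : Fin 3 → Fin n} → v ≗ w → Increasing₃ v → Increasing₃ w
Increasing₃-≗ v≗w (v₀<v₁ , v₁<v₂) =
  subst₂ _<_ (v≗w 0F) (v≗w 1F) v₀<v₁ , subst₂ _<_ (v≗w 1F) (v≗w 2F) v₁<v₂

increasing₃⇒< : ∀ {n} {v : Fin 3 → Fin n} → Increasing₃ v → ∀ {s t} → s < t → v s < v t
increasing₃⇒< (v₀<v₁ , v₁<v₂) {0F} {1F} _ = v₀<v₁
increasing₃⇒< (v₀<v₁ , v₁<v₂) {0F} {2F} _ = <-trans v₀<v₁ v₁<v₂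
increasing₃⇒< (v₀<v₁ , v₁<v₂) {1F} {2F} _ = v₁<v₂
increasing₃⇒< _ {1F} {1F} (s<s ())
increasing₃⇒< _ {2F} {1F} (s<s ())
increasing₃⇒< _ {2F} {2F} (s<s (s<s ()))

increasing₃-reflects-< : ∀ {n} {v : Fin 3 → Fin n} → Increasing₃ v → ∀ {s t} → v s < v t → s < t
increasing₃-reflects-< v-inc {s} {t} vs<vt with <-cmp s t
... | tri< s<t _ _ = s<t
... | tri≈ _ refl _ = ⊥-elim (<-irrefl refl vs<vt)
... | tri> _ _ t<s = ⊥-elim (<-asym vs<vt (increasing₃⇒< v-inc t<s))

-- An occurrence of the pattern σ with inverse τ: positions ι 0F < ι 1F < ι 2F whose values,
-- read in the order τ (from the smallest entry of σ to the largest), increase.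
Occurs : ∀ {n} → (Fin 3 → Fin 3) → (Fin n → Fin n) → Set
Occurs {n} τ f = Σ (Fin 3 → Fin n) λ ι → Increasing₃ ι × Increasing₃ (f ∘ ι ∘ τ)

Occurs-≗ : ∀ {n} {τ} {f g : Fin n → Fin n} → f ≗ g → Occurs τ f → Occurs τ g
Occurs-≗ {τ = τ} f≗g (ι , ι-inc , v-inc) = ι , ι-inc , Increasing₃-≗ (f≗g ∘ ι ∘ τ) v-inc

Occurs-reorder : ∀ {n} {τ τ′} {f : Fin n → Fin n} → τ ≗ τ′ → Occurs τ f → Occurs τ′ f
Occurs-reorder {f = f} τ≗τ′ (ι , ι-inc , v-inc) = ι , ι-inc , Increasing₃-≗ (cong (f ∘ ι) ∘ τ≗τ′) v-inc

contains-< : ∀ {n} (π : Perm n) {σ : Perm 3} ((ι , _) : Contains π σ) →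
             ∀ s t → ⟦ σ ⟧ s < ⟦ σ ⟧ t → ⟦ π ⟧ (ι s) < ⟦ π ⟧ (ι t)
contains-< π (ι , ι-inc , ord) s t σs<σt with <-cmp s t
... | tri≈ _ refl _ = ⊥-elim (<-irrefl refl σs<σt)
... | tri> _ _ t<s  = proj₂ (ord t s t<s) σs<σt
... | tri< s<t _ _ with <-cmp (⟦ π ⟧ (ι s)) (⟦ π ⟧ (ι t))
...   | tri< πs<πt _ _ = πs<πt
...   | tri≈ _ πs≡πt _ = ⊥-elim (<-irrefl (⟦⟧-injective π πs≡πt) (ι-inc s t s<t))
...   | tri> _ _ πt<πs = ⊥-elim (<-asym σs<σt (proj₁ (ord s t s<t) πt<πs))

contains⇒occurs : ∀ {n} (π : Perm n) {σ : Perm 3} {τ} → StrictlyInverseˡ _≡_ ⟦ σ ⟧ τ →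
                  Contains π σ → Occurs τ ⟦ π ⟧
contains⇒occurs π {σ} {τ} σ∘τ≗id c@(ι , ι-inc , _) =
  ι , (ι-inc 0F 1F z<s , ι-inc 1F 2F (s<s z<s)) , (ordered 0F 1F z<s , ordered 1F 2F (s<s z<s))
  where
  ordered : ∀ k l → k < l → ⟦ π ⟧ (ι (τ k)) < ⟦ π ⟧ (ι (τ l))
  ordered k l k<l = contains-< π {σ} c (τ k) (τ l) (subst₂ _<_ (sym (σ∘τ≗id k)) (sym (σ∘τ≗id l)) k<l)

occurs⇒contains : ∀ {n} (π : Perm n) {σ : Perm 3} {τ} → StrictlyInverseʳ _≡_ ⟦ σ ⟧ τ →
                  Occurs τ ⟦ π ⟧ → Contains π σ
occurs⇒contains {n} π {σ} {τ} τ∘σ≗id (ι , ι-inc , v-inc) =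
  ι , (λ _ _ → increasing₃⇒< {v = ι} ι-inc) ,
  λ s t _ → (λ πt<πs → increasing₃-reflects-< {v = v} v-inc (subst₂ _<_ (at t) (at s) πt<πs))
          , (λ σt<σs → subst₂ _<_ (sym (at t)) (sym (at s)) (increasing₃⇒< {v = v} v-inc σt<σs))
  where
  v : Fin 3 → Fin n
  v = ⟦ π ⟧ ∘ ι ∘ τ
  at : ∀ s → ⟦ π ⟧ (ι s) ≡ v (⟦ σ ⟧ s)
  at s = cong (⟦ π ⟧ ∘ ι) (sym (τ∘σ≗id s))

record EdgeTransposition (n : ℕ) (i j : Fin 3) : Set where
  field
    sw               : Fin n → Fin n
    sw-involutive    : ∀ x → sw (sw x) ≡ x
    sw-increasing₃   : ∀ {v : Fin 3 → Fin n} → Increasing₃ v →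
                       Increasing₃ (sw ∘ v) ⊎ Increasing₃ (sw ∘ v ∘ transpose i j)

module _ {n} {i j : Fin 3} (E : EdgeTransposition n i j) where
  open EdgeTransposition E

  private
    t : Fin 3 → Fin 3
    t = transpose i j
    t-involutive : ∀ s → t (t s) ≡ s
    t-involutive = transpose-involutive i j

  occurs-valueSwap : ∀ {τ f} → Occurs τ f → Occurs τ (sw ∘ f) ⊎ Occurs (τ ∘ t) (sw ∘ f)
  occurs-valueSwap {τ} {f} (ι , ι-inc , v-inc) =
    Sum.map (λ inc → ι , ι-inc , inc) (λ inc → ι , ι-inc , inc) (sw-increasing₃ {f ∘ ι ∘ τ} v-inc)

  occurs-positionSwap : ∀ {τ f} → Occurs τ f → Occurs τ (f ∘ sw) ⊎ Occurs (t ∘ τ) (f ∘ sw)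
  occurs-positionSwap {τ} {f} (ι , ι-inc , v-inc) = Sum.map
    (λ swι-inc → sw ∘ ι , swι-inc ,
       Increasing₃-≗ (λ s → cong f (sym (sw-involutive (ι (τ s))))) v-inc)
    (λ swιt-inc → sw ∘ ι ∘ t , swιt-inc ,
       Increasing₃-≗ (λ s → cong f (sym (trans (sw-involutive _) (cong ι (t-involutive (τ s)))))) v-inc)
    (sw-increasing₃ {ι} ι-inc)

  occursEither-valueSwap : ∀ τ f → Occurs τ f ⊎ Occurs (τ ∘ t) f → Occurs τ (sw ∘ f) ⊎ Occurs (τ ∘ t) (sw ∘ f)
  occursEither-valueSwap τ f (inj₁ o) = occurs-valueSwap {τ} {f} o
  occursEither-valueSwap τ f (inj₂ o) =
    Sum.[ inj₂ , inj₁ ∘ Occurs-reorder {τ = τ ∘ t ∘ t} {f = sw ∘ f} (cong τ ∘ t-involutive) ]′ (occurs-valueSwap {τ ∘ t} {f} o)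

  occursEither-positionSwap : ∀ τ f → Occurs τ f ⊎ Occurs (t ∘ τ) f → Occurs τ (f ∘ sw) ⊎ Occurs (t ∘ τ) (f ∘ sw)
  occursEither-positionSwap τ f (inj₁ o) = occurs-positionSwap {τ} {f} o
  occursEither-positionSwap τ f (inj₂ o) =
    Sum.[ inj₂ , inj₁ ∘ Occurs-reorder {τ = t ∘ t ∘ τ} {f = f ∘ sw} (t-involutive ∘ τ) ]′ (occurs-positionSwap {t ∘ τ} {f} o)

module AdjacentTransposition {n} {a b : Fin n} (adj : toℕ b ≡ suc (toℕ a)) where

  swap : Fin n → Fin n
  swap = transpose a b

  swap-involutive : ∀ x → swap (swap x) ≡ x
  swap-involutive = transpose-involutive a b

  swap-injective : Injective _≡_ _≡_ swap
  swap-injective {x} {y} e = trans (sym (swap-involutive x)) (trans (cong swap e) (swap-involutive y))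

  a<b : a < b
  a<b = ℕ.≤-reflexive (sym adj)

  a≢b : a ≢ b
  a≢b a≡b = <-irrefl a≡b a<b

  <b⇒≤a : ∀ {x : Fin n} → x < b → x Fin.≤ a
  <b⇒≤a {x} x<b = s≤s⁻¹ (subst (suc (toℕ x) ≤_) adj x<b)

  a<⇒b≤ : ∀ {x : Fin n} → a < x → b Fin.≤ x
  a<⇒b≤ {x} a<x = subst (_≤ toℕ x) (sym adj) a<x

  ind-ordered : ∀ {x y} → x ≡ a → y ≡ b → ind (x <? y) ≡ 1
  ind-ordered refl refl = ind-yes (a <? b) a<b

  ind-reversed : ∀ {x y} → x ≡ a → y ≡ b → ind (y <? x) ≡ 0
  ind-reversed refl refl = ind-no (b <? a) (<-asym a<b)

  swap-mono : ∀ {x y} → x < y → (x , y) ≢ (a , b) → swap x < swap y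
  swap-mono {x} {y} x<y xy≢ab with transpose-cases a b x | transpose-cases a b y
  ... | inj₁ (refl , _)          | inj₁ (refl , _)                = ⊥-elim (<-irrefl refl x<y)
  ... | inj₁ (refl , _)          | inj₂ (inj₁ (refl , _))         = contradiction refl xy≢ab
  ... | inj₁ (refl , sx)         | inj₂ (inj₂ (_ , y≢b , sy))     =
    subst₂ _<_ (sym sx) (sym sy) (≤∧≢⇒< (a<⇒b≤ x<y) (y≢b ∘ sym))
  ... | inj₂ (inj₁ (refl , _))   | inj₁ (refl , _)                = contradiction a<b (<-asym x<y)
  ... | inj₂ (inj₁ (refl , _))   | inj₂ (inj₁ (refl , _))         = ⊥-elim (<-irrefl refl x<y)
  ... | inj₂ (inj₁ (refl , sx))  | inj₂ (inj₂ (_ , _ , sy))       =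
    subst₂ _<_ (sym sx) (sym sy) (<-trans a<b x<y)
  ... | inj₂ (inj₂ (_ , _ , sx)) | inj₁ (refl , sy)               =
    subst₂ _<_ (sym sx) (sym sy) (<-trans x<y a<b)
  ... | inj₂ (inj₂ (x≢a , _ , sx)) | inj₂ (inj₁ (refl , sy))      =
    subst₂ _<_ (sym sx) (sym sy) (≤∧≢⇒< (<b⇒≤a x<y) x≢a)
  ... | inj₂ (inj₂ (_ , _ , sx)) | inj₂ (inj₂ (_ , _ , sy))       =
    subst₂ _<_ (sym sx) (sym sy) x<y

  swap-reverses : ∀ {x y} → (x , y) ≡ (a , b) → swap y < swap x
  swap-reverses refl = subst₂ _<_ (sym (transposeʳ a b)) (sym (transposeˡ a b)) a<b

  ind-swap< : ∀ {x y} → (x , y) ≢ (a , b) → (x , y) ≢ (b , a) → ind (swap x <? swap y) ≡ ind (x <? y)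
  ind-swap< {x} {y} xy≢ab xy≢ba =
    ind-⇔ (swap x <? swap y) (x <? y) reflect (λ x<y → swap-mono x<y xy≢ab)
    where
    unswap : (swap x , swap y) ≡ (a , b) → (x , y) ≡ (b , a)
    unswap e = cong₂ _,_
      (trans (sym (swap-involutive x)) (trans (cong swap (,-injectiveˡ e)) (transposeˡ a b)))
      (trans (sym (swap-involutive y)) (trans (cong swap (,-injectiveʳ e)) (transposeʳ a b)))
    reflect : swap x < swap y → x < y
    reflect sx<sy = subst₂ _<_ (swap-involutive x) (swap-involutive y) (swap-mono sx<sy (xy≢ba ∘ unswap))

  inversions-∘swap : ∀ {f : Fin n → Fin n} → Injective _≡_ _≡_ f →
                     OneApart (inversions (f ∘ swap)) (inversions f)
  inversions-∘swap {f} f-inj = oneApart-by-comparison (a≢b ∘ f-inj) (begin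
    inversions (f ∘ swap) + ind (f b <? f a)  ≡⟨ cong₂ _+_ reindexed d-entries ⟨
    sum² c + (d a b + d b a)                  ≡⟨ sum²-agreeOff₂ a≢b agree ⟩
    inversions f + (c a b + c b a)            ≡⟨ cong (inversions f +_) c-entries ⟩
    inversions f + ind (f a <? f b)           ∎)
    where
    open ≡-Reasoning
    c d : Fin n → Fin n → ℕ
    c i j = ind (swap i <? swap j) * ind (f j <? f i)
    d i j = ind (i <? j) * ind (f j <? f i)
    reindexed : sum² c ≡ inversions (f ∘ swap)
    reindexed = sym (trans (sum²-permute _ (Permutation.transpose a b))
      (sum-cong-≗ λ i → sum-cong-≗ λ j → cong₂ (λ u v → ind (swap i <? swap j) * ind (f u <? f v))
        (swap-involutive j) (swap-involutive i)))
    agree : ∀ i j → (i , j) ≢ (a , b) → (i , j) ≢ (b , a) → c i j ≡ d i j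
    agree i j ij≢ab ij≢ba = cong (_* ind (f j <? f i)) (ind-swap< ij≢ab ij≢ba)
    d-entries : d a b + d b a ≡ ind (f b <? f a)
    d-entries = trans (cong₂ (λ u v → u * ind (f b <? f a) + v * ind (f a <? f b))
                        (ind-ordered refl refl) (ind-reversed refl refl))
                      (trans (ℕ.+-identityʳ _) (ℕ.*-identityˡ _))
    c-entries : c a b + c b a ≡ ind (f a <? f b)
    c-entries = trans (cong₂ (λ u v → u * ind (f b <? f a) + v * ind (f a <? f b))
                        (ind-reversed (transposeʳ a b) (transposeˡ a b))
                        (ind-ordered (transposeʳ a b) (transposeˡ a b)))
                      (ℕ.*-identityˡ _)

  inversions-swap∘-at : ∀ {f : Fin n → Fin n} → Injective _≡_ _≡_ f → ∀ {i₀ j₀} → f i₀ ≡ a → f j₀ ≡ b →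
                        OneApart (inversions (swap ∘ f)) (inversions f)
  inversions-swap∘-at {f} f-inj {i₀} {j₀} fi₀ fj₀ = oneApart-by-comparison i₀≢j₀ (begin
    inversions (swap ∘ f) + ind (j₀ <? i₀)       ≡⟨ cong (inversions (swap ∘ f) +_) d-entries ⟨
    inversions (swap ∘ f) + (d i₀ j₀ + d j₀ i₀)  ≡⟨ sum²-agreeOff₂ i₀≢j₀ agree ⟩
    inversions f + (c i₀ j₀ + c j₀ i₀)           ≡⟨ cong (inversions f +_) c-entries ⟩
    inversions f + ind (i₀ <? j₀)                ∎)
    where
    open ≡-Reasoning
    i₀≢j₀ : i₀ ≢ j₀
    i₀≢j₀ i₀≡j₀ = a≢b (trans (sym fi₀) (trans (cong f i₀≡j₀) fj₀))
    c d : Fin n → Fin n → ℕ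
    c i j = ind (i <? j) * ind (swap (f j) <? swap (f i))
    d i j = ind (i <? j) * ind (f j <? f i)
    preimage : ∀ {i j} → (f i , f j) ≡ (a , b) → (i , j) ≡ (i₀ , j₀)
    preimage e = cong₂ _,_ (f-inj (trans (,-injectiveˡ e) (sym fi₀))) (f-inj (trans (,-injectiveʳ e) (sym fj₀)))
    agree : ∀ i j → (i , j) ≢ (i₀ , j₀) → (i , j) ≢ (j₀ , i₀) → c i j ≡ d i j
    agree i j ij≢i₀j₀ ij≢j₀i₀ = cong (ind (i <? j) *_) (ind-swap<
      (ij≢j₀i₀ ∘ cong Product.swap ∘ preimage)
      (ij≢i₀j₀ ∘ preimage ∘ cong Product.swap))
    swap-fi₀ : swap (f i₀) ≡ b
    swap-fi₀ = trans (cong swap fi₀) (transposeˡ a b)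
    swap-fj₀ : swap (f j₀) ≡ a
    swap-fj₀ = trans (cong swap fj₀) (transposeʳ a b)
    d-entries : d i₀ j₀ + d j₀ i₀ ≡ ind (j₀ <? i₀)
    d-entries = trans (cong₂ (λ u v → ind (i₀ <? j₀) * u + ind (j₀ <? i₀) * v)
                        (ind-reversed fi₀ fj₀) (ind-ordered fi₀ fj₀))
                      (cong₂ _+_ (ℕ.*-zeroʳ (ind (i₀ <? j₀))) (ℕ.*-identityʳ _))
    c-entries : c i₀ j₀ + c j₀ i₀ ≡ ind (i₀ <? j₀)
    c-entries = trans (cong₂ (λ u v → ind (i₀ <? j₀) * u + ind (j₀ <? i₀) * v)
                        (ind-ordered swap-fj₀ swap-fi₀) (ind-reversed swap-fj₀ swap-fi₀))
                      (trans (cong₂ _+_ (ℕ.*-identityʳ _) (ℕ.*-zeroʳ (ind (j₀ <? i₀)))) (ℕ.+-identityʳ _))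

  inversions-swap∘ : ∀ {f : Fin n → Fin n} → Injective _≡_ _≡_ f →
                     OneApart (inversions (swap ∘ f)) (inversions f)
  inversions-swap∘ f-inj = inversions-swap∘-at f-inj
    (proj₂ (injective⇒strictlySurjective f-inj a)) (proj₂ (injective⇒strictlySurjective f-inj b))

  swap-increasing₃ : ∀ {v : Fin 3 → Fin n} → Increasing₃ v →
                     Increasing₃ (swap ∘ v) ⊎
                     (v 1F ≡ b × Increasing₃ (swap ∘ v ∘ transpose 0F 1F)) ⊎
                     (v 1F ≡ a × Increasing₃ (swap ∘ v ∘ transpose 1F 2F))
  swap-increasing₃ {v} (v₀<v₁ , v₁<v₂)
    with ≡-dec _≟_ _≟_ (v 0F , v 1F) (a , b) | ≡-dec _≟_ _≟_ (v 1F , v 2F) (a , b)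
  ... | yes v₀₁≡ab | _ =
    inj₂ (inj₁ (,-injectiveʳ v₀₁≡ab , swap-reverses v₀₁≡ab , swap-mono (<-trans v₀<v₁ v₁<v₂) v₀₂≢ab))
    where
    v₀₂≢ab : (v 0F , v 2F) ≢ (a , b)
    v₀₂≢ab e = <-irrefl (trans (,-injectiveʳ v₀₁≡ab) (sym (,-injectiveʳ e))) v₁<v₂
  ... | no _ | yes v₁₂≡ab =
    inj₂ (inj₂ (,-injectiveˡ v₁₂≡ab , swap-mono (<-trans v₀<v₁ v₁<v₂) v₀₂≢ab , swap-reverses v₁₂≡ab))
    where
    v₀₂≢ab : (v 0F , v 2F) ≢ (a , b)
    v₀₂≢ab e = <-irrefl (trans (,-injectiveˡ e) (sym (,-injectiveˡ v₁₂≡ab))) v₀<v₁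
  ... | no v₀₁≢ab | no v₁₂≢ab = inj₁ (swap-mono v₀<v₁ v₀₁≢ab , swap-mono v₁<v₂ v₁₂≢ab)

  bottomEdge : (∀ {x} → x ≮ a) → EdgeTransposition n 0F 1F
  bottomEdge a-least = record
    { sw = swap ; sw-involutive = swap-involutive ; sw-increasing₃ = λ {v} → increasing₃ {v} }
    where
    increasing₃ : ∀ {v} → Increasing₃ v → Increasing₃ (swap ∘ v) ⊎ Increasing₃ (swap ∘ v ∘ transpose 0F 1F)
    increasing₃ {v} v-inc with swap-increasing₃ {v} v-inc
    ... | inj₁ inc               = inj₁ inc
    ... | inj₂ (inj₁ (_ , inc))  = inj₂ inc
    ... | inj₂ (inj₂ (v₁≡a , _)) = ⊥-elim (a-least (subst (v 0F <_) v₁≡a (proj₁ v-inc)))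

  topEdge : (∀ {x} → b ≮ x) → EdgeTransposition n 1F 2F
  topEdge b-greatest = record
    { sw = swap ; sw-involutive = swap-involutive ; sw-increasing₃ = λ {v} → increasing₃ {v} }
    where
    increasing₃ : ∀ {v} → Increasing₃ v → Increasing₃ (swap ∘ v) ⊎ Increasing₃ (swap ∘ v ∘ transpose 1F 2F)
    increasing₃ {v} v-inc with swap-increasing₃ {v} v-inc
    ... | inj₁ inc               = inj₁ inc
    ... | inj₂ (inj₁ (v₁≡b , _)) = ⊥-elim (b-greatest (subst (_< v 2F) v₁≡b (proj₂ v-inc)))
    ... | inj₂ (inj₂ (_ , inc))  = inj₂ inc

  valueTransposition : SignReversingAction n
  valueTransposition = record
    { act            = swap ∘_
    ; act-injective  = λ f-inj → f-inj ∘ swap-injective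
    ; act-cong       = λ f≗g → cong swap ∘ f≗g
    ; act-involutive = λ f → swap-involutive ∘ f
    ; inversions-act = inversions-swap∘
    }

  positionTransposition : SignReversingAction n
  positionTransposition = record
    { act            = _∘ swap
    ; act-injective  = λ f-inj → swap-injective ∘ f-inj
    ; act-cong       = λ f≗g → f≗g ∘ swap
    ; act-involutive = λ f → cong f ∘ swap-involutive
    ; inversions-act = inversions-∘swap
    }

record Inverse₃ (σ : Perm 3) (τ : Fin 3 → Fin 3) : Set where
  constructor inverse₃
  field
    σ∘τ≗id : StrictlyInverseˡ _≡_ ⟦ σ ⟧ τ
    τ∘σ≗id : StrictlyInverseʳ _≡_ ⟦ σ ⟧ τ

signBalanced-Av2 : ∀ {n} (R : SignReversingAction n) {σ₁ σ₂ τ₁ τ₂} → Inverse₃ σ₁ τ₁ → Inverse₃ σ₂ τ₂ →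
                   (∀ f → Occurs τ₁ f ⊎ Occurs τ₂ f →
                            Occurs τ₁ (SignReversingAction.act R f) ⊎ Occurs τ₂ (SignReversingAction.act R f)) →
                   SignBalanced n (Av2 σ₁ σ₂)
signBalanced-Av2 R {σ₁} {σ₂} {τ₁} {τ₂} (inverse₃ σ₁∘τ₁ τ₁∘σ₁) (inverse₃ σ₂∘τ₂ τ₂∘σ₂) closed =
  signBalanced (Av2 σ₁ σ₂) (λ {π} → preserves {π})
  where
  open SignReversingAction R
  pullback : ∀ π → Occurs τ₁ ⟦ actₚ π ⟧ ⊎ Occurs τ₂ ⟦ actₚ π ⟧ → Contains π σ₁ ⊎ Contains π σ₂
  pullback π =
    Sum.map (occurs⇒contains π {σ₁} {τ₁} τ₁∘σ₁ ∘ back τ₁) (occurs⇒contains π {σ₂} {τ₂} τ₂∘σ₂ ∘ back τ₂)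
    ∘ closed (act ⟦ π ⟧) ∘ Sum.map (forth τ₁) (forth τ₂)
    where
    forth : ∀ τ → Occurs τ ⟦ actₚ π ⟧ → Occurs τ (act ⟦ π ⟧)
    forth τ = Occurs-≗ {τ = τ} (⟦actₚ⟧ π)
    back : ∀ τ → Occurs τ (act (act ⟦ π ⟧)) → Occurs τ ⟦ π ⟧
    back τ = Occurs-≗ {τ = τ} (act-involutive ⟦ π ⟧)
  preserves : ∀ {π} → Av2 σ₁ σ₂ π → Av2 σ₁ σ₂ (actₚ π)
  preserves {π} (avoids₁ , avoids₂) =
      (λ c → Sum.[ avoids₁ , avoids₂ ]′ (pullback π (inj₁ (contains⇒occurs (actₚ π) {σ₁} {τ₁} σ₁∘τ₁ c))))
    , (λ c → Sum.[ avoids₁ , avoids₂ ]′ (pullback π (inj₂ (contains⇒occurs (actₚ π) {σ₂} {τ₂} σ₂∘τ₂ c))))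

Fin3-cases : ∀ {P : Fin 3 → Set} → P 0F → P 1F → P 2F → ∀ k → P k
Fin3-cases p₀ _  _  0F = p₀
Fin3-cases _  p₁ _  1F = p₁
Fin3-cases _  _  p₂ 2F = p₂

p132-inverse : Inverse₃ p132 ⟦ p132 ⟧
p132-inverse = inverse₃ (Fin3-cases refl refl refl) (Fin3-cases refl refl refl)

p231-inverse : Inverse₃ p231 ⟦ p312 ⟧
p231-inverse = inverse₃ (Fin3-cases refl refl refl) (Fin3-cases refl refl refl)

p312-inverse : Inverse₃ p312 ⟦ p231 ⟧
p312-inverse = inverse₃ (Fin3-cases refl refl refl) (Fin3-cases refl refl refl)

p213-inverse : Inverse₃ p213 ⟦ p213 ⟧
p213-inverse = inverse₃ (Fin3-cases refl refl refl) (Fin3-cases refl refl refl)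

fromℕ-greatest : ∀ m {x : Fin (suc m)} → fromℕ m ≮ x
fromℕ-greatest m {x} m<x = ℕ.<⇒≱ m<x (≤fromℕ x)

module Bottom (m : ℕ) = AdjacentTransposition {suc (suc m)} {Fin.zero} {Fin.suc Fin.zero} refl
module Top (m : ℕ) = AdjacentTransposition {suc (suc m)} {inject₁ (fromℕ m)} {fromℕ (suc m)}
  (cong suc (sym (toℕ-inject₁ (fromℕ m))))

signBalanced-132-231 : ∀ m → SignBalanced (suc (suc m)) (Av2 p132 p231)
signBalanced-132-231 m = signBalanced-Av2 (Bottom.valueTransposition m) p132-inverse p231-inverse
  (occursEither-valueSwap (Bottom.bottomEdge m λ ()) ⟦ p132 ⟧)

signBalanced-312-213 : ∀ m → SignBalanced (suc (suc m)) (Av2 p312 p213)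
signBalanced-312-213 m = signBalanced-Av2 (Top.valueTransposition m) p312-inverse p213-inverse
  (occursEither-valueSwap (Top.topEdge m (fromℕ-greatest (suc m))) ⟦ p231 ⟧)

signBalanced-132-312 : ∀ m → SignBalanced (suc (suc m)) (Av2 p132 p312)
signBalanced-132-312 m = signBalanced-Av2 (Bottom.positionTransposition m) p132-inverse p312-inverse
  (occursEither-positionSwap (Bottom.bottomEdge m λ ()) ⟦ p132 ⟧)

signBalanced-231-213 : ∀ m → SignBalanced (suc (suc m)) (Av2 p231 p213)
signBalanced-231-213 m = signBalanced-Av2 (Top.positionTransposition m) p231-inverse p213-inverse
  (occursEither-positionSwap (Top.topEdge m (fromℕ-greatest (suc m))) ⟦ p312 ⟧)

proposition3p1 : (n : ℕ) → n > 1 →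
    SignBalanced n (Av2 p132 p231) × SignBalanced n (Av2 p312 p213) ×
    SignBalanced n (Av2 p132 p312) × SignBalanced n (Av2 p231 p213)
proposition3p1 (suc (suc m)) (s<s (s<s _)) =
  signBalanced-132-231 m , signBalanced-312-213 m , signBalanced-132-312 m , signBalanced-231-213 m
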